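{- Let $\mathcal E$ be an exchangeability system for a noncommutative probability space $(\mathcal A,\phi)$, let $X_{i,j}\in\mathcal A$ for $i\in[m]$, $j\in[n_i]$, $n=n_1+\dots+n_m$, with $[n]$ identified with $\{(i,j):i\in[m],j\in[n_i]\}$ ordered lexicographically, and let $\pi\in\Pi_m$. Then $$K_\pi\Bigl(\prod_{j=1}^{n_1}X_{1,j},\dots,\prod_{j=1}^{n_m}X_{m,j}\Bigr)=\sum_{\substack{\sigma\in\Pi_n\\ \sigma\vee\tilde{\hat0}_m=\tilde\pi}}K_\sigma(X_{1,1},X_{1,2},\dots,X_{m,n_m}),$$ where the products are ordered by increasing $j$.
   Context: A noncommutative probability space is a pair $(\mathcal A,\phi)$ of a complex unital algebra $\mathcal A$ and a unital linear functional $\phi$. An exchangeability system $\mathcal E$ for $(\mathcal A,\phi)$ consists of a noncommutative probability space $(\mathcal U,\tilde\phi)$ and embeddings (injective unital homomorphisms) $\iota_k:\mathcal A\to\mathcal U$, $k\in\mathbb N$, with $\tilde\phi\circ\iota_k=\phi$; write $X^{(k)}=\iota_k(X)$. It is required that for all $n$, all $X_1,\dots,X_n\in\mathcal A$, all indices $i_1,\dots,i_n\in\mathbb N$ and every permutation $\sigma$ of $\mathbb N$: $\tilde\phi(X_1^{(i_1)}\cdots X_n^{(i_n)})=\tilde\phi(X_1^{(\sigma(i_1))}\cdots X_n^{(\sigma(i_n))})$. Thus this value depends only on the kernel of $j\mapsto i_j$; for a set partition $\sigma$ of $[n]$ denote it $\phi_\sigma(X_1,\dots,X_n)$. $\Pi_n$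 is the lattice of set partitions of $[n]$ under refinement, with join $\vee$ and Möbius function $\mu$; the partitioned cumulant is $K_\sigma=\sum_{\tau\le\sigma}\phi_\tau\,\mu(\tau,\sigma)$. Every $\pi\in\Pi_m$ induces $\tilde\pi\in\Pi_n$ whose blocks are $\tilde B=\{(i,j):i\in B,j\in[n_i]\}$ for $B\in\pi$; $\hat0_m$ is the partition of $[m]$ into singletons, so $\tilde{\hat0}_m$ has the blocks $\{(i,j):j\in[n_i]\}$, $i\in[m]$. -}

module Defs where

open import Level using (Level; _⊔_) renaming (suc to lsuc)
open import Algebra.Bundles using (CommutativeRing; Ring)
open import Data.Nat using (ℕ; zero; suc; _≡ᵇ_; _≤ᵇ_)
open import Data.Fin using (Fin; toℕ)
open import Data.Bool using (Bool; true; false; _∧_; _∨_; not; if_then_else_; T)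
open import Data.List using (List; []; _∷_; map; concatMap; filter; foldr; upTo; allFin)
open import Data.Vec using (Vec; []; _∷_; lookup; zipWith; tabulate; replicate; _++_)
import Data.Vec as Vec
open import Function.Bundles using (_↔_; Inverse)
open import Relation.Binary.PropositionalEquality using (_≡_)

record UnitalAlgebra {c ℓ} (S : CommutativeRing c ℓ) (a ℓa : Level)
       : Set (lsuc (c ⊔ ℓ ⊔ a ⊔ ℓa)) where
  private
    module S = CommutativeRing S
  field
    ring : Ring a ℓa
  open Ring ring public
  infixr 7 _·_
  field
    _·_        : S.Carrier → Carrier → Carrier
    ·-cong     : ∀ {s t x y} → s S.≈ t → x ≈ y → s · x ≈ t · y
    ·-distribˡ : ∀ s x y → s · (x + y) ≈ s · x + s · y
    ·-distribʳ : ∀ s t x → (s S.+ t) · x ≈ s · x + t · x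
    ·-assoc    : ∀ s t x → (s S.* t) · x ≈ s · (t · x)
    ·-identity : ∀ x → S.1# · x ≈ x
    ·-*-assocˡ : ∀ s x y → (s · x) * y ≈ s · (x * y)
    ·-*-assocʳ : ∀ s x y → x * (s · y) ≈ s · (x * y)

module _ {a ℓa} (R : Ring a ℓa) where
  open Ring R
  prodV : ∀ {n} → Vec Carrier n → Carrier
  prodV []       = 1#
  prodV (x ∷ xs) = x * prodV xs

record NCProbSpace {c ℓ} (S : CommutativeRing c ℓ) (a ℓa : Level)
       : Set (lsuc (c ⊔ ℓ ⊔ a ⊔ ℓa)) where
  private
    module S = CommutativeRing S
  field
    algebra : UnitalAlgebra S a ℓa
  open UnitalAlgebra algebra public
  field
    φ       : Carrier → S.Carrier
    φ-cong  : ∀ {x y} → x ≈ y → φ x S.≈ φ y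
    φ-+     : ∀ x y → φ (x + y) S.≈ φ x S.+ φ y
    φ-·     : ∀ s x → φ (s · x) S.≈ s S.* φ x
    φ-unit  : φ 1# S.≈ S.1#

record ExchangeabilitySystem {c ℓ} {S : CommutativeRing c ℓ} {a ℓa}
       (P : NCProbSpace S a ℓa) (u ℓu : Level)
       : Set (lsuc (c ⊔ ℓ ⊔ a ⊔ ℓa ⊔ u ⊔ ℓu)) where
  private
    module S = CommutativeRing S
    module A = NCProbSpace P
  field
    𝒰 : NCProbSpace S u ℓu
  private
    module U = NCProbSpace 𝒰
  field
    ι        : ℕ → A.Carrier → U.Carrier
    ι-cong   : ∀ k {x y} → x A.≈ y → ι k x U.≈ ι k y
    ι-+      : ∀ k x y → ι k (x A.+ y) U.≈ ι k x U.+ ι k y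
    ι-*      : ∀ k x y → ι k (x A.* y) U.≈ ι k x U.* ι k y
    ι-·      : ∀ k s x → ι k (s A.· x) U.≈ s U.· ι k x
    ι-1      : ∀ k → ι k A.1# U.≈ U.1#
    ι-inj    : ∀ k {x y} → ι k x U.≈ ι k y → x A.≈ y
    ι-φ      : ∀ k x → U.φ (ι k x) S.≈ A.φ x
    exchangeable : ∀ n (X : Vec A.Carrier n) (is : Vec ℕ n) (σ : ℕ ↔ ℕ) →
      U.φ (prodV U.ring (zipWith ι is X))
        S.≈ U.φ (prodV U.ring (zipWith ι (Vec.map (Inverse.to σ) is) X))

-- Set partitions of [n], encoded as restricted growth strings:
-- a vector of block labels (blocks numbered 0,1,2,… in order of their
-- least element).

allVecs : ℕ → (n : ℕ) → List (Vec ℕ n)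
allVecs k zero    = [] ∷ []
allVecs k (suc n) = concatMap (λ a → map (a ∷_) (allVecs k n)) (upTo k)

-- restricted growth check; c = next unused label
rgsFrom : ∀ {n} → ℕ → Vec ℕ n → Bool
rgsFrom c []       = true
rgsFrom c (a ∷ v)  = (a ≤ᵇ c) ∧ rgsFrom (if a ≡ᵇ c then suc c else c) v

isPartition : ∀ {n} → Vec ℕ n → Bool
isPartition = rgsFrom 0

Π : (n : ℕ) → List (Vec ℕ n)
Π n = filter (λ v → T? (isPartition v)) (allVecs n n)
  where
  open import Relation.Nullary.Decidable using (Dec; yes; no)
  open import Data.Bool.Properties using (T?)

allB : ∀ {x} {X : Set x} → List X → (X → Bool) → Bool
allB xs p = foldr (λ x b → p x ∧ b) true xs

_≤ₚ_ : ∀ {n} → Vec ℕ n → Vec ℕ n → Bool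
_≤ₚ_ {n} τ σ = allB (allFin n) λ i → allB (allFin n) λ j →
  not (lookup τ i ≡ᵇ lookup τ j) ∨ (lookup σ i ≡ᵇ lookup σ j)

_≈ₚ_ : ∀ {n} → Vec ℕ n → Vec ℕ n → Bool
τ ≈ₚ σ = (τ ≤ₚ σ) ∧ (σ ≤ₚ τ)

isJoin : ∀ {n} → Vec ℕ n → Vec ℕ n → Vec ℕ n → Bool
isJoin {n} σ ρ ξ = (σ ≤ₚ ξ) ∧ (ρ ≤ₚ ξ) ∧
  allB (Π n) (λ η → not ((σ ≤ₚ η) ∧ (ρ ≤ₚ η)) ∨ (ξ ≤ₚ η))

module _ {c ℓ} (S : CommutativeRing c ℓ) where
  open CommutativeRing S

  sumL : ∀ {x} {X : Set x} → List X → (X → Carrier) → Carrier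
  sumL xs f = foldr (λ x s → f x + s) 0# xs

  sumWhere : ∀ {x} {X : Set x} → List X → (X → Bool) → (X → Carrier) → Carrier
  sumWhere xs p f = sumL xs (λ x → if p x then f x else 0#)

  -- Defined by recursion on a fuel parameter bounding the length of [x,y];
  -- chains in Π n have length < n, so fuel n suffices.
  möbiusF : ∀ {n} → ℕ → Vec ℕ n → Vec ℕ n → Carrier
  möbiusF zero x y = if x ≈ₚ y then 1# else 0#
  möbiusF {n} (suc k) x y =
    if x ≈ₚ y then 1#
    else if x ≤ₚ y
      then - sumWhere (Π n) (λ z → (x ≤ₚ z) ∧ (z ≤ₚ y) ∧ not (z ≈ₚ y))
                            (λ z → möbiusF k x z)
      else 0#

  μ : ∀ {n} → Vec ℕ n → Vec ℕ n → Carrier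
  μ {n} = möbiusF n

module _ {c ℓ} {S : CommutativeRing c ℓ} {a ℓa} {P : NCProbSpace S a ℓa} {u ℓu}
         (E : ExchangeabilitySystem P u ℓu) where
  private
    module S = CommutativeRing S
    module A = NCProbSpace P
    module E = ExchangeabilitySystem E
    module U = NCProbSpace E.𝒰

  -- φ_σ(X₁,…,Xₙ) = φ̃(X₁^{(i₁)} ⋯ Xₙ^{(iₙ)}) with ker(j ↦ i_j) = σ
  -- (we take i_j = label of the block of σ containing j)
  φₚ : ∀ {n} → Vec ℕ n → Vec A.Carrier n → S.Carrier
  φₚ σ X = U.φ (prodV U.ring (zipWith E.ι σ X))

  K : ∀ {n} → Vec ℕ n → Vec A.Carrier n → S.Carrier
  K {n} σ X = sumWhere S (Π n) (λ τ → τ ≤ₚ σ) (λ τ → φₚ τ X S.* μ S τ σ)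

sumF : ∀ {m} → (Fin m → ℕ) → ℕ
sumF {zero}  ns = 0
sumF {suc m} ns = ns Fin.zero + sumF (λ i → ns (Fin.suc i))
  where
  open import Data.Nat using (_+_)
  import Data.Fin as Fin

concatF : ∀ {x} {X : Set x} {m} (ns : Fin m → ℕ) →
          ((i : Fin m) → Vec X (ns i)) → Vec X (sumF ns)
concatF {m = zero}  ns v = []
concatF {m = suc m} ns v = v Fin.zero ++ concatF (λ i → ns (Fin.suc i)) (λ i → v (Fin.suc i))
  where import Data.Fin as Fin

tilde : ∀ {m} (ns : Fin m → ℕ) → Vec ℕ m → Vec ℕ (sumF ns)
tilde ns π = concatF ns (λ i → replicate (ns i) (lookup π i))

0̂ : (m : ℕ) → Vec ℕ m
0̂ m = tabulate toℕ

module Submission where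

-- Write Yᵢ = Xᵢ₁ ⋯ Xᵢₙᵢ. As every ι k is multiplicative, φ_τ(Y) = φ_τ̃(X) for all τ ∈ Πₘ.
-- Both sides of the identity, viewed as functions F of π, therefore satisfy
-- Σ_{ρ ≤ τ} F ρ = φ_τ(Y) for every τ: for the left side this is the moment–cumulant
-- formula on Πₘ; for the right side, exchanging the two sums leaves Σ_{σ ≤ τ̃} K_σ(X),
-- which is φ_τ̃(X) by the moment–cumulant formula on Πₙ, because each σ ∈ Πₙ has
-- σ ∨ 0̃ = ρ̃ for exactly one ρ, and that ρ is ≤ τ iff σ ≤ τ̃. Functions with the same
-- lower sums agree, by induction on the number of blocks.

open import Defs
open import Algebra.Bundles using (CommutativeRing; Ring)
open import Data.Bool using (Bool; true; false; not; _∧_; _∨_; if_then_else_; T; T?)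
open import Data.Bool.Properties using (∧-assoc; T-≡)
open import Data.Fin as Fin using (Fin; zero; suc; toℕ; inject; Fin′)
import Data.Fin.Properties as Fin
open import Data.List as List using (List; []; _∷_; length; filter; allFin; upTo)
open import Data.List.Membership.Propositional using (_∈_; _∉_; lose)
open import Data.List.Membership.Propositional.Properties
  using (∈-allFin; ∈-map⁺; ∈-map⁻; ∈-concat⁺′; ∈-upTo⁺; ∈-filter⁺; ∈-filter⁻; ∈-cartesianProduct⁺)
import Data.List.Properties as List
open import Data.List.Relation.Unary.Any using (Any; here; there)
import Data.List.Relation.Unary.All as All
open import Data.List.Relation.Unary.Unique.Propositional using (Unique; []; _∷_)
open import Data.List.Relation.Unary.Unique.Propositional.Properties using (upTo⁺)
open import Data.Maybe using (Maybe; just; nothing)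
open import Data.Nat as ℕ using (ℕ; zero; suc; _≤_; _<_; _∸_; _≡ᵇ_; _≤ᵇ_; z≤n; s≤s)
open import Data.Nat.Induction using (<-wellFounded)
open import Data.Nat.Properties as ℕ
  using (≡ᵇ⇒≡; ≡⇒≡ᵇ; ≤ᵇ⇒≤; ≤⇒≤ᵇ; _≟_; ≤-refl; ≤-trans; ≤-antisym; m≤n⇒m≤1+n; <⇒≢; ≮⇒≥; n<1+n)
open import Data.Product using (_×_; _,_; proj₁; proj₂; ∃; ∃₂)
open import Data.Sum using (inj₁; inj₂; [_,_]′)
open import Data.Unit using (tt)
open import Data.Vec as Vec using (Vec; []; _∷_; lookup; tabulate)
import Data.Vec.Properties as Vec
open import Data.Vec.Relation.Unary.All using (All; []; _∷_)
open import Function using (_∘_)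
open import Function.Bundles using (Equivalence)
open import Induction.WellFounded using (Acc; acc)
open import Relation.Binary using (tri<; tri≈; tri>)
open import Relation.Binary.PropositionalEquality using (_≡_; _≢_; refl; sym; trans; cong; cong₂; subst)
import Relation.Binary.PropositionalEquality as ≡
open import Relation.Nullary using (¬_; Dec; yes; no; ¬?; _→-dec_; contradiction; decidable-stable)
open import Relation.Unary using (Pred; Decidable)

private
  variable
    n : ℕ

T-∧⁺ : ∀ {a b} → T a → T b → T (a ∧ b)
T-∧⁺ {true} _ tb = tb

T-∧ˡ : ∀ {a b} → T (a ∧ b) → T a
T-∧ˡ {true} _ = tt

T-∧ʳ : ∀ {a b} → T (a ∧ b) → T b
T-∧ʳ {true} t = t

T-⇒⁺ : ∀ {a b} → (T a → T b) → T (not a ∨ b)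
T-⇒⁺ {true} f = f tt
T-⇒⁺ {false} _ = tt

T-⇒⁻ : ∀ {a b} → T (not a ∨ b) → T a → T b
T-⇒⁻ {true} t _ = t

T-not⁻ : ∀ {a} → T (not a) → ¬ T a
T-not⁻ {true} ()

allB⁺ : ∀ {x} {X : Set x} (xs : List X) (p : X → Bool) → (∀ x → T (p x)) → T (allB xs p)
allB⁺ []       p h = tt
allB⁺ (x ∷ xs) p h = T-∧⁺ (h x) (allB⁺ xs p h)

allB⁻ : ∀ {x} {X : Set x} (xs : List X) (p : X → Bool) → T (allB xs p) → ∀ {y} → y ∈ xs → T (p y)
allB⁻ (x ∷ xs) p t (here refl) = T-∧ˡ t
allB⁻ (x ∷ xs) p t (there y∈) = allB⁻ xs p (T-∧ʳ {p x} t) y∈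

T-ext : ∀ {a b} → (T a → T b) → (T b → T a) → a ≡ b
T-ext {true}  {true}  _ _ = refl
T-ext {true}  {false} f _ = contradiction (f tt) λ ()
T-ext {false} {true}  _ g = contradiction (g tt) λ ()
T-ext {false} {false} _ _ = refl

-- Refinement and the number of blocks

infix 4 _⊑_

_⊑_ : Vec ℕ n → Vec ℕ n → Set
x ⊑ y = ∀ i j → lookup x i ≡ lookup x j → lookup y i ≡ lookup y j

⊑-refl : (x : Vec ℕ n) → x ⊑ x
⊑-refl x i j e = e

⊑-trans : {x y z : Vec ℕ n} → x ⊑ y → y ⊑ z → x ⊑ z
⊑-trans x⊑y y⊑z i j e = y⊑z i j (x⊑y i j e)

⊑⇒≤ₚ : (x y : Vec ℕ n) → x ⊑ y → T (x ≤ₚ y)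
⊑⇒≤ₚ {n} x y x⊑y = allB⁺ (allFin n) _ λ i → allB⁺ (allFin n) _ λ j →
  T-⇒⁺ λ t → ≡⇒≡ᵇ _ _ (x⊑y i j (≡ᵇ⇒≡ _ _ t))

≤ₚ⇒⊑ : (x y : Vec ℕ n) → T (x ≤ₚ y) → x ⊑ y
≤ₚ⇒⊑ {n} x y t i j e =
  ≡ᵇ⇒≡ _ _ (T-⇒⁻ (allB⁻ (allFin n) _ (allB⁻ (allFin n) _ t (∈-allFin i)) (∈-allFin j)) (≡⇒≡ᵇ _ _ e))

≈ₚ⇒⊑ : (x y : Vec ℕ n) → T (x ≈ₚ y) → x ⊑ y × y ⊑ x
≈ₚ⇒⊑ x y t = ≤ₚ⇒⊑ x y (T-∧ˡ t) , ≤ₚ⇒⊑ y x (T-∧ʳ {x ≤ₚ y} t)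

⊑⇒≈ₚ : (x y : Vec ℕ n) → x ⊑ y → y ⊑ x → T (x ≈ₚ y)
⊑⇒≈ₚ x y x⊑y y⊑x = T-∧⁺ (⊑⇒≤ₚ x y x⊑y) (⊑⇒≤ₚ y x y⊑x)

0̂-⊑ : ∀ {m} (τ : Vec ℕ m) → 0̂ m ⊑ τ
0̂-⊑ {m} τ i j e = cong (lookup τ) (Fin.toℕ-injective
  (trans (sym (Vec.lookup∘tabulate toℕ i)) (trans e (Vec.lookup∘tabulate toℕ j))))
module _ {a p q} {A : Set a} {P : Pred A p} {Q : Pred A q}
         (P? : Decidable P) (Q? : Decidable Q) (P⇒Q : ∀ {x} → P x → Q x) where

  length-filter-mono : ∀ xs → length (filter P? xs) ≤ length (filter Q? xs)
  length-filter-mono []       = z≤n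
  length-filter-mono (x ∷ xs) with P? x | Q? x
  ... | yes _  | yes _  = s≤s (length-filter-mono xs)
  ... | yes px | no ¬qx = contradiction (P⇒Q px) ¬qx
  ... | no _   | yes _  = m≤n⇒m≤1+n (length-filter-mono xs)
  ... | no _   | no _   = length-filter-mono xs

  length-filter-strict : ∀ {xs} → Any (λ x → Q x × ¬ P x) xs →
                         length (filter P? xs) < length (filter Q? xs)
  length-filter-strict {x ∷ xs} (here (qx , ¬px)) with P? x | Q? x
  ... | yes px | _      = contradiction px ¬px
  ... | no _   | yes _  = s≤s (length-filter-mono xs)
  ... | no _   | no ¬qx = contradiction qx ¬qx
  length-filter-strict {x ∷ xs} (there any) with P? x | Q? x
  ... | yes _  | yes _  = s≤s (length-filter-strict any)
  ... | yes px | no ¬qx = contradiction (P⇒Q px) ¬qx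
  ... | no _   | yes _  = ℕ.m<n⇒m<1+n (length-filter-strict any)
  ... | no _   | no _   = length-filter-strict any

Opens : Vec ℕ n → Fin n → Set
Opens v k = ∀ (j : Fin′ k) → lookup v (inject j) ≢ lookup v k

opens? : (v : Vec ℕ n) → Decidable (Opens v)
opens? v k = Fin.all? λ j → ¬? (lookup v (inject j) ≟ lookup v k)

-- Blocks are counted by their least elements; a coarser labelling has fewer such positions.
blockCount : Vec ℕ n → ℕ
blockCount {n} v = length (filter (opens? v) (allFin n))

blockCount≤n : (v : Vec ℕ n) → blockCount v ≤ n
blockCount≤n {n} v = subst (blockCount v ≤_) (List.length-tabulate _) (List.length-filter (opens? v) (allFin n))

blockCount-pos : (v : Vec ℕ (suc n)) → 1 ≤ blockCount v
blockCount-pos {n} v = List.filter-some (opens? v) {allFin (suc n)} (here λ ())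

<⇒∃inject : {i k : Fin n} → i Fin.< k → ∃ λ (j : Fin′ k) → inject j ≡ i
<⇒∃inject {i = zero}  {suc k} _         = zero , refl
<⇒∃inject {i = suc i} {suc k} (s≤s i<k) with <⇒∃inject i<k
... | j , refl = suc j , refl

firstOccurrence : (v : Vec ℕ n) (i : Fin n) → ∃ λ k → Opens v k × lookup v k ≡ lookup v i
firstOccurrence {n} v i with Fin.¬∀⟶∃¬-smallest n (λ k → lookup v k ≢ lookup v i)
                                (λ k → ¬? (lookup v k ≟ lookup v i)) (λ all≢ → all≢ i refl)
... | k , ¬≢ , before = k , (λ j e → before j (trans e vk≡vi)) , vk≡vi
  where vk≡vi = decidable-stable (lookup v k ≟ lookup v i) ¬≢

⊑-opens : {v w : Vec ℕ n} → v ⊑ w → ∀ {k} → Opens w k → Opens v k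
⊑-opens {w = w} v⊑w {k} opens j e = opens j (v⊑w (inject j) k e)

repeated⇒¬Opens : (v : Vec ℕ n) {i k : Fin n} → i Fin.< k → lookup v i ≡ lookup v k → ¬ Opens v k
repeated⇒¬Opens v i<k e opens with <⇒∃inject i<k
... | j , refl = opens j e

⊑-at? : (w v : Vec ℕ n) (i j : Fin n) → Dec (lookup w i ≡ lookup w j → lookup v i ≡ lookup v j)
⊑-at? w v i j = (lookup w i ≟ lookup w j) →-dec (lookup v i ≟ lookup v j)

¬⊑-witness : (w v : Vec ℕ n) → ¬ w ⊑ v → ∃₂ λ i j → lookup w i ≡ lookup w j × lookup v i ≢ lookup v j
¬⊑-witness {n} w v w⋢v
  with i , ¬Pi ← Fin.¬∀⟶∃¬ n _ (λ i → Fin.all? λ j → ⊑-at? w v i j) w⋢v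
  with j , ¬Qij ← Fin.¬∀⟶∃¬ n _ (⊑-at? w v i) ¬Pi
  with lookup w i ≟ lookup w j
... | yes wi≡wj = i , j , wi≡wj , λ vi≡vj → ¬Qij λ _ → vi≡vj
... | no wi≢wj  = contradiction (λ wi≡wj → contradiction wi≡wj wi≢wj) ¬Qij

-- The first occurrences of two v-blocks that w merges are distinct, and the later one
-- opens a block of v but not of w.
blockCount-strict : (v w : Vec ℕ n) → v ⊑ w → ¬ w ⊑ v → blockCount w < blockCount v
blockCount-strict {n} v w v⊑w w⋢v
  with i , j , wi≡wj , vi≢vj ← ¬⊑-witness w v w⋢v
  with k₁ , opens₁ , vk₁≡vi ← firstOccurrence v i
  with k₂ , opens₂ , vk₂≡vj ← firstOccurrence v j
  = length-filter-strict (opens? w) (opens? v) (⊑-opens {v = v} {w} v⊑w)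
                         (lose (∈-allFin (proj₁ witness)) (proj₂ witness))
  where
  wk₁≡wk₂ : lookup w k₁ ≡ lookup w k₂
  wk₁≡wk₂ = trans (v⊑w k₁ i vk₁≡vi) (trans wi≡wj (sym (v⊑w k₂ j vk₂≡vj)))
  witness : ∃ λ k → Opens v k × ¬ Opens w k
  witness with Fin.<-cmp k₁ k₂
  ... | tri< k₁<k₂ _ _ = k₂ , opens₂ , repeated⇒¬Opens w k₁<k₂ wk₁≡wk₂
  ... | tri≈ _ refl _  = contradiction (trans (sym vk₁≡vi) vk₂≡vj) vi≢vj
  ... | tri> _ _ k₂<k₁ = k₁ , opens₁ , repeated⇒¬Opens w k₂<k₁ (sym wk₁≡wk₂)

-- Restricted growth strings

≡ᵇ≡true⇒≡ : ∀ {a b} → (a ≡ᵇ b) ≡ true → a ≡ b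
≡ᵇ≡true⇒≡ {a} {b} eq = ≡ᵇ⇒≡ a b (subst T (sym eq) tt)

≡ᵇ-refl : ∀ a → (a ≡ᵇ a) ≡ true
≡ᵇ-refl a = Equivalence.to T-≡ (≡⇒≡ᵇ a a refl)

nextLabel : ℕ → ℕ → ℕ
nextLabel c a = if a ≡ᵇ c then suc c else c

rgsFrom-head : ∀ c a (v : Vec ℕ n) → T (rgsFrom c (a ∷ v)) → a ≤ c
rgsFrom-head c a v t = ≤ᵇ⇒≤ a c (T-∧ˡ t)

rgsFrom-tail : ∀ c a (v : Vec ℕ n) → T (rgsFrom c (a ∷ v)) → T (rgsFrom (nextLabel c a) v)
rgsFrom-tail c a v t = T-∧ʳ {a ≤ᵇ c} t

nextLabel-old : ∀ {b c} → b < c → nextLabel c b ≡ c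
nextLabel-old {b} {c} b<c with b ≡ᵇ c in eq
... | true  = contradiction (≡ᵇ≡true⇒≡ eq) (<⇒≢ b<c)
... | false = refl

nextLabel-self : ∀ c → nextLabel c c ≡ suc c
nextLabel-self c rewrite ≡ᵇ-refl c = refl

nextLabel-new : ∀ c a {b} → b < nextLabel c a → ¬ b < c → a ≡ c × b ≡ c
nextLabel-new c a b<next b≮c with a ≡ᵇ c in eq
... | true  = ≡ᵇ≡true⇒≡ eq , ≤-antisym (ℕ.≤-pred b<next) (≮⇒≥ b≮c)
... | false = contradiction b<next b≮c

SameLabelsBelow : ℕ → Vec ℕ n → Vec ℕ n → Set
SameLabelsBelow c v w = ∀ a → a < c → ∀ i → (lookup v i ≡ a → lookup w i ≡ a) × (lookup w i ≡ a → lookup v i ≡ a)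

-- Labels below c are determined by the positions carrying them; any other label is forced
-- to be the next unused one, c.
rgsFrom-unique : ∀ c (v w : Vec ℕ n) → T (rgsFrom c v) → T (rgsFrom c w) →
                 v ⊑ w → w ⊑ v → SameLabelsBelow c v w → v ≡ w
rgsFrom-unique c []      []      _  _  _   _   _    = refl
rgsFrom-unique c (a ∷ v) (b ∷ w) tv tw v⊑w w⊑v same =
  cong₂ _∷_ a≡b (rgsFrom-unique (nextLabel c a) v w (rgsFrom-tail c a v tv) tw′
                  (λ i j → v⊑w (suc i) (suc j)) (λ i j → w⊑v (suc i) (suc j)) same′)
  where
  a≡b : a ≡ b
  a≡b with a ℕ.<? c | b ℕ.<? c
  ... | yes a<c | _       = sym (proj₁ (same a a<c zero) refl)
  ... | no _    | yes b<c = proj₂ (same b b<c zero) refl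
  ... | no a≮c  | no b≮c  = trans (≤-antisym (rgsFrom-head c a v tv) (≮⇒≥ a≮c))
                                  (sym (≤-antisym (rgsFrom-head c b w tw) (≮⇒≥ b≮c)))
  tw′ : T (rgsFrom (nextLabel c a) w)
  tw′ = subst (λ x → T (rgsFrom (nextLabel c x) w)) (sym a≡b) (rgsFrom-tail c b w tw)
  same′ : SameLabelsBelow (nextLabel c a) v w
  same′ a′ a′<next i with a′ ℕ.<? c
  ... | yes a′<c = same a′ a′<c (suc i)
  ... | no a′≮c with a≡c , a′≡c ← nextLabel-new c a a′<next a′≮c
    = (λ e → trans (sym (v⊑w zero (suc i) (trans a≡a′ (sym e)))) (trans (sym a≡b) a≡a′))
    , (λ e → trans (sym (w⊑v zero (suc i) (trans (sym a≡b) (trans a≡a′ (sym e))))) a≡a′)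
    where a≡a′ = trans a≡c (sym a′≡c)

partition-unique : (v w : Vec ℕ n) → T (isPartition v) → T (isPartition w) → v ⊑ w → w ⊑ v → v ≡ w
partition-unique v w tv tw v⊑w w⊑v = rgsFrom-unique 0 v w tv tw v⊑w w⊑v λ _ ()

rgsFrom-bounded : ∀ c k (v : Vec ℕ n) → T (rgsFrom c v) → c ℕ.+ n ≤ k → All (_< k) v
rgsFrom-bounded c k []      t le = []
rgsFrom-bounded {suc n} c k (a ∷ v) t le =
  ≤-trans (s≤s (≤-trans (rgsFrom-head c a v t) (ℕ.m≤m+n c n))) le′
  ∷ rgsFrom-bounded (nextLabel c a) k v (rgsFrom-tail c a v t) (≤-trans (next+n≤ (a ≡ᵇ c)) le′)
  where
  le′ : suc c ℕ.+ n ≤ k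
  le′ = subst (_≤ k) (ℕ.+-suc c n) le
  next+n≤ : ∀ b → (if b then suc c else c) ℕ.+ n ≤ suc c ℕ.+ n
  next+n≤ true  = ≤-refl
  next+n≤ false = ℕ.n≤1+n (c ℕ.+ n)

allVecs-complete : ∀ k (v : Vec ℕ n) → All (_< k) v → v ∈ allVecs k n
allVecs-complete k []      []            = here refl
allVecs-complete k (a ∷ v) (a<k ∷ v<k) =
  ∈-concat⁺′ (∈-map⁺ (a ∷_) (allVecs-complete k v v<k)) (∈-map⁺ _ (∈-upTo⁺ a<k))

∈Π : (v : Vec ℕ n) → T (isPartition v) → v ∈ Π n
∈Π {n} v t = ∈-filter⁺ (λ v → T? (isPartition v)) (allVecs-complete n v (rgsFrom-bounded 0 n v t ≤-refl)) t

∈Π⁻ : {v : Vec ℕ n} → v ∈ Π n → T (isPartition v)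
∈Π⁻ {n} v∈ = proj₂ (∈-filter⁻ (λ v → T? (isPartition v)) {xs = allVecs n n} v∈)

≤ₚ-refl : (x : Vec ℕ n) → T (x ≤ₚ x)
≤ₚ-refl x = ⊑⇒≤ₚ x x (⊑-refl x)

≈ₚ-refl : (x : Vec ℕ n) → T (x ≈ₚ x)
≈ₚ-refl x = ⊑⇒≈ₚ x x (⊑-refl x) (⊑-refl x)

≈ₚ⇒≡ : (x y : Vec ℕ n) → T (isPartition x) → T (isPartition y) → T (x ≈ₚ y) → x ≡ y
≈ₚ⇒≡ x y tx ty x≈y = partition-unique x y tx ty (proj₁ (≈ₚ⇒⊑ x y x≈y)) (proj₂ (≈ₚ⇒⊑ x y x≈y))

blockCount-<ₚ : (x y : Vec ℕ n) → T (x ≤ₚ y) → ¬ T (y ≤ₚ x) → blockCount y < blockCount x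
blockCount-<ₚ x y x≤y y≰x = blockCount-strict x y (≤ₚ⇒⊑ x y x≤y) (λ y⊑x → y≰x (⊑⇒≤ₚ y x y⊑x))

isJoin⁺ : (σ ρ ξ : Vec ℕ n) → σ ⊑ ξ → ρ ⊑ ξ → (∀ η → σ ⊑ η → ρ ⊑ η → ξ ⊑ η) → T (isJoin σ ρ ξ)
isJoin⁺ {n} σ ρ ξ σ⊑ξ ρ⊑ξ least =
  T-∧⁺ (⊑⇒≤ₚ σ ξ σ⊑ξ) (T-∧⁺ (⊑⇒≤ₚ ρ ξ ρ⊑ξ) (allB⁺ (Π n) _ λ η → T-⇒⁺ λ t →
  ⊑⇒≤ₚ ξ η (least η (≤ₚ⇒⊑ σ η (T-∧ˡ t)) (≤ₚ⇒⊑ ρ η (T-∧ʳ {σ ≤ₚ η} t)))))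

isJoin⁻ : (σ ρ ξ : Vec ℕ n) → T (isJoin σ ρ ξ) →
          σ ⊑ ξ × (∀ η → T (isPartition η) → σ ⊑ η → ρ ⊑ η → ξ ⊑ η)
isJoin⁻ {n} σ ρ ξ t = ≤ₚ⇒⊑ σ ξ (T-∧ˡ t) , λ η tη σ⊑η ρ⊑η →
  ≤ₚ⇒⊑ ξ η (T-⇒⁻ (allB⁻ (Π n) _ (T-∧ʳ {ρ ≤ₚ ξ} (T-∧ʳ {σ ≤ₚ ξ} t)) (∈Π η tη))
                  (T-∧⁺ (⊑⇒≤ₚ σ η σ⊑η) (⊑⇒≤ₚ ρ η ρ⊑η)))

-- Normalising and merging labellings

assoc : ℕ → List (ℕ × ℕ) → Maybe ℕ
assoc a []            = nothing
assoc a ((x , y) ∷ H) with a ≟ x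
... | yes _ = just y
... | no _  = assoc a H

assoc-just : ∀ a H {b} → assoc a H ≡ just b → (a , b) ∈ H
assoc-just a ((x , y) ∷ H) e with a ≟ x | e
... | yes refl | refl = here refl
... | no _     | e′   = there (assoc-just a H e′)

assoc-nothing : ∀ a H {b} → assoc a H ≡ nothing → (a , b) ∉ H
assoc-nothing a ((x , y) ∷ H) e ab∈ with a ≟ x | e | ab∈
... | no a≢x | _  | here refl = a≢x refl
... | no _   | e′ | there ab∈′ = assoc-nothing a H e′ ab∈′

-- H assigns restricted-growth labels to the labels met so far; c is the next unused one.
normFrom : List (ℕ × ℕ) → ℕ → Vec ℕ n → Vec ℕ n
normFrom H c []      = []
normFrom H c (a ∷ v) with assoc a H
... | just b  = b ∷ normFrom H c v
... | nothing = c ∷ normFrom ((a , c) ∷ H) (suc c) v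

normalise : Vec ℕ n → Vec ℕ n
normalise = normFrom [] 0

LabelsBelow : ℕ → List (ℕ × ℕ) → Set
LabelsBelow c H = ∀ {a b} → (a , b) ∈ H → b < c

LabelsBelow-extend : ∀ {c H} a → LabelsBelow c H → LabelsBelow (suc c) ((a , c) ∷ H)
LabelsBelow-extend a below (here refl) = n<1+n _
LabelsBelow-extend a below (there ab∈) = ℕ.m<n⇒m<1+n (below ab∈)

normFrom-rgs : ∀ H c (v : Vec ℕ n) → LabelsBelow c H → T (rgsFrom c (normFrom H c v))
normFrom-rgs H c []      below = tt
normFrom-rgs H c (a ∷ v) below with assoc a H in eq
... | just b  = T-∧⁺ (≤⇒≤ᵇ (ℕ.<⇒≤ b<c))
                     (subst (λ c′ → T (rgsFrom c′ (normFrom H c v))) (sym (nextLabel-old b<c)) (normFrom-rgs H c v below))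
  where b<c = below (assoc-just a H eq)
... | nothing = T-∧⁺ (≤⇒≤ᵇ (≤-refl {c}))
                     (subst (λ c′ → T (rgsFrom c′ (normFrom ((a , c) ∷ H) (suc c) v))) (sym (nextLabel-self c))
                            (normFrom-rgs ((a , c) ∷ H) (suc c) v (LabelsBelow-extend a below)))

record PartialBijection (H : List (ℕ × ℕ)) : Set where
  field
    functional : ∀ {a b a′ b′} → (a , b) ∈ H → (a′ , b′) ∈ H → a ≡ a′ → b ≡ b′
    injective  : ∀ {a b a′ b′} → (a , b) ∈ H → (a′ , b′) ∈ H → b ≡ b′ → a ≡ a′

PartialBijection-extend : ∀ {H a c} → (∀ {b} → (a , b) ∉ H) → (∀ {a′} → (a′ , c) ∉ H) →
                          PartialBijection H → PartialBijection ((a , c) ∷ H)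
PartialBijection-extend {H} {a} {c} a-new c-new bij = record { functional = functional′ ; injective = injective′ }
  where
  open PartialBijection bij
  functional′ : ∀ {x y x′ y′} → (x , y) ∈ (a , c) ∷ H → (x′ , y′) ∈ (a , c) ∷ H → x ≡ x′ → y ≡ y′
  functional′ (here refl) (here refl) _    = refl
  functional′ (here refl) (there m′)  refl = contradiction m′ a-new
  functional′ (there m)   (here refl) refl = contradiction m a-new
  functional′ (there m)   (there m′)  e    = functional m m′ e
  injective′ : ∀ {x y x′ y′} → (x , y) ∈ (a , c) ∷ H → (x′ , y′) ∈ (a , c) ∷ H → y ≡ y′ → x ≡ x′
  injective′ (here refl) (here refl) _    = refl
  injective′ (here refl) (there m′)  refl = contradiction m′ c-new
  injective′ (there m)   (here refl) refl = contradiction m c-new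
  injective′ (there m)   (there m′)  e    = injective m m′ e

normFrom-graph : ∀ H c (v : Vec ℕ n) → LabelsBelow c H → PartialBijection H →
  ∃ λ H′ → (∀ {p} → p ∈ H → p ∈ H′) × PartialBijection H′ ×
           (∀ i → (lookup v i , lookup (normFrom H c v) i) ∈ H′)
normFrom-graph H c []      below bij = H , (λ p∈ → p∈) , bij , λ ()
normFrom-graph H c (a ∷ v) below bij with assoc a H in eq
... | just b with H′ , H⊆H′ , bij′ , graph ← normFrom-graph H c v below bij =
  H′ , H⊆H′ , bij′ , λ { zero → H⊆H′ (assoc-just a H eq) ; (suc i) → graph i }
... | nothing with H′ , H⊆H′ , bij′ , graph ← normFrom-graph ((a , c) ∷ H) (suc c) v (LabelsBelow-extend a below)
                   (PartialBijection-extend (assoc-nothing a H eq) (λ ac∈ → <⇒≢ (below ac∈) refl) bij) =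
  H′ , (λ p∈ → H⊆H′ (there p∈)) , bij′ , λ { zero → H⊆H′ (here refl) ; (suc i) → graph i }

normalise-isPartition : (v : Vec ℕ n) → T (isPartition (normalise v))
normalise-isPartition v = normFrom-rgs [] 0 v λ ()

normalise-graph : (v : Vec ℕ n) → ∃ λ H → PartialBijection H × ∀ i → (lookup v i , lookup (normalise v) i) ∈ H
normalise-graph v
  with H , _ , bij , graph ← normFrom-graph [] 0 v (λ ()) (record { functional = λ () ; injective = λ () })
  = H , bij , graph

⊑-normalise : (v : Vec ℕ n) → v ⊑ normalise v
⊑-normalise v i j with H , bij , graph ← normalise-graph v = PartialBijection.functional bij (graph i) (graph j)

normalise-⊑ : (v : Vec ℕ n) → normalise v ⊑ v
normalise-⊑ v i j with H , bij , graph ← normalise-graph v = PartialBijection.injective bij (graph i) (graph j)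

relabel : ℕ → ℕ → ℕ → ℕ
relabel old new a = if a ≡ᵇ old then new else a

mergeLabels : Vec ℕ n → Fin n → Fin n → Vec ℕ n
mergeLabels L i j = Vec.map (relabel (lookup L j) (lookup L i)) L

mergeAll : Vec ℕ n → List (Fin n × Fin n) → Vec ℕ n
mergeAll L []             = L
mergeAll L ((i , j) ∷ es) = mergeAll (mergeLabels L i j) es

lookup-mergeLabels : (L : Vec ℕ n) (i j k : Fin n) →
                     lookup (mergeLabels L i j) k ≡ relabel (lookup L j) (lookup L i) (lookup L k)
lookup-mergeLabels L i j k = Vec.lookup-map k _ L

⊑-mergeLabels : (L : Vec ℕ n) (i j : Fin n) → L ⊑ mergeLabels L i j
⊑-mergeLabels L i j k k′ e =
  trans (lookup-mergeLabels L i j k) (trans (cong (relabel _ _) e) (sym (lookup-mergeLabels L i j k′)))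

relabel-old : ∀ old new → relabel old new old ≡ new
relabel-old old new rewrite ≡ᵇ-refl old = refl

relabel-new : ∀ old new → relabel old new new ≡ new
relabel-new old new with new ≡ᵇ old
... | true  = refl
... | false = refl

mergeLabels-joins : (L : Vec ℕ n) (i j : Fin n) → lookup (mergeLabels L i j) i ≡ lookup (mergeLabels L i j) j
mergeLabels-joins L i j = begin
  lookup (mergeLabels L i j) i              ≡⟨ lookup-mergeLabels L i j i ⟩
  relabel (lookup L j) (lookup L i) (lookup L i) ≡⟨ relabel-new (lookup L j) (lookup L i) ⟩
  lookup L i                                ≡⟨ relabel-old (lookup L j) (lookup L i) ⟨
  relabel (lookup L j) (lookup L i) (lookup L j) ≡⟨ lookup-mergeLabels L i j j ⟨
  lookup (mergeLabels L i j) j              ∎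
  where open ≡.≡-Reasoning

mergeLabels-⊑ : {L θ : Vec ℕ n} (i j : Fin n) → L ⊑ θ → lookup θ i ≡ lookup θ j → mergeLabels L i j ⊑ θ
mergeLabels-⊑ {L = L} {θ} i j L⊑θ θi≡θj k k′ e =
  merged (lookup L k ≡ᵇ lookup L j) (lookup L k′ ≡ᵇ lookup L j) refl refl
         (trans (sym (lookup-mergeLabels L i j k)) (trans e (lookup-mergeLabels L i j k′)))
  where
  merged : ∀ b b′ → (lookup L k ≡ᵇ lookup L j) ≡ b → (lookup L k′ ≡ᵇ lookup L j) ≡ b′ →
           (if b then lookup L i else lookup L k) ≡ (if b′ then lookup L i else lookup L k′) →
           lookup θ k ≡ lookup θ k′
  merged true  true  e₁ e₂ _ = trans (L⊑θ k j (≡ᵇ≡true⇒≡ e₁)) (sym (L⊑θ k′ j (≡ᵇ≡true⇒≡ e₂)))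
  merged true  false e₁ _  e = trans (L⊑θ k j (≡ᵇ≡true⇒≡ e₁)) (trans (sym θi≡θj) (L⊑θ i k′ e))
  merged false true  _  e₂ e = trans (L⊑θ k i e) (trans θi≡θj (sym (L⊑θ k′ j (≡ᵇ≡true⇒≡ e₂))))
  merged false false _  _  e = L⊑θ k k′ e

⊑-mergeAll : (L : Vec ℕ n) (es : List (Fin n × Fin n)) → L ⊑ mergeAll L es
⊑-mergeAll L []             = ⊑-refl L
⊑-mergeAll L ((i , j) ∷ es) = ⊑-trans {x = L} {mergeLabels L i j} {mergeAll (mergeLabels L i j) es}
                                      (⊑-mergeLabels L i j) (⊑-mergeAll (mergeLabels L i j) es)

mergeAll-joins : (L : Vec ℕ n) (es : List (Fin n × Fin n)) {i j : Fin n} →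
                 (i , j) ∈ es → lookup (mergeAll L es) i ≡ lookup (mergeAll L es) j
mergeAll-joins L ((i , j) ∷ es) (here refl) = ⊑-mergeAll (mergeLabels L i j) es i j (mergeLabels-joins L i j)
mergeAll-joins L ((i , j) ∷ es) (there e∈) = mergeAll-joins (mergeLabels L i j) es e∈

mergeAll-⊑ : {L θ : Vec ℕ n} (es : List (Fin n × Fin n)) → L ⊑ θ →
             (∀ {i j} → (i , j) ∈ es → lookup θ i ≡ lookup θ j) → mergeAll L es ⊑ θ
mergeAll-⊑ []             L⊑θ respects = L⊑θ
mergeAll-⊑ {L = L} {θ} ((i , j) ∷ es) L⊑θ respects =
  mergeAll-⊑ {L = mergeLabels L i j} {θ} es (mergeLabels-⊑ {L = L} {θ} i j L⊑θ (respects (here refl)))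
             (λ e∈ → respects (there e∈))

-- The block decomposition [n₁ + ⋯ + nₘ] = [n₁] ⊎ ⋯ ⊎ [nₘ]

blockOf : ∀ {m} (ns : Fin m → ℕ) → Fin (sumF ns) → Fin m
blockOf {suc m} ns p = [ (λ _ → zero) , (λ q → suc (blockOf (ns ∘ suc) q)) ]′ (Fin.splitAt (ns zero) p)

lookup-tilde : ∀ {m} (ns : Fin m → ℕ) (ρ : Vec ℕ m) p → lookup (tilde ns ρ) p ≡ lookup ρ (blockOf ns p)
lookup-tilde {suc m} ns (a ∷ ρ) p
  rewrite Vec.lookup-splitAt (ns zero) (Vec.replicate (ns zero) a) (tilde (ns ∘ suc) ρ) p
  with Fin.splitAt (ns zero) p
... | inj₁ i = Vec.lookup-replicate i a
... | inj₂ q = lookup-tilde (ns ∘ suc) ρ q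

firstOfBlock : ∀ {m} (ns : Fin m → ℕ) → (∀ i → 1 ≤ ns i) → Fin m → Fin (sumF ns)
firstOfBlock {suc m} ns nonempty zero    = Fin.fromℕ< (nonempty zero) Fin.↑ˡ sumF (ns ∘ suc)
firstOfBlock {suc m} ns nonempty (suc i) = ns zero Fin.↑ʳ firstOfBlock (ns ∘ suc) (nonempty ∘ suc) i

blockOf-firstOfBlock : ∀ {m} (ns : Fin m → ℕ) (nonempty : ∀ i → 1 ≤ ns i) i →
                       blockOf ns (firstOfBlock ns nonempty i) ≡ i
blockOf-firstOfBlock {suc m} ns nonempty zero
  rewrite Fin.splitAt-↑ˡ (ns zero) (Fin.fromℕ< (nonempty zero)) (sumF (ns ∘ suc)) = refl
blockOf-firstOfBlock {suc m} ns nonempty (suc i)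
  rewrite Fin.splitAt-↑ʳ (ns zero) (sumF (ns ∘ suc)) (firstOfBlock (ns ∘ suc) (nonempty ∘ suc) i) =
  cong suc (blockOf-firstOfBlock (ns ∘ suc) (nonempty ∘ suc) i)

nextLabel-above : ∀ {c a} → a ≤ c → a < nextLabel c a
nextLabel-above {c} {a} a≤c with a ≡ᵇ c in eq
... | true  = s≤s a≤c
... | false = ℕ.≤∧≢⇒< a≤c λ a≡c → subst T eq (≡⇒≡ᵇ a c a≡c)

rgsFrom-repeated : ∀ {c a l} k (r : Vec ℕ l) → 1 ≤ k → a ≤ c → T (rgsFrom (nextLabel c a) r) →
                   T (rgsFrom c (Vec.replicate k a Vec.++ r))
rgsFrom-repeated {c} {a} (suc k) r _ a≤c t = T-∧⁺ (≤⇒≤ᵇ a≤c) (repeat k)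
  where
  a<c′ = nextLabel-above a≤c
  repeat : ∀ k → T (rgsFrom (nextLabel c a) (Vec.replicate k a Vec.++ r))
  repeat zero    = t
  repeat (suc k) = T-∧⁺ (≤⇒≤ᵇ (ℕ.<⇒≤ a<c′))
                        (subst (λ c′ → T (rgsFrom c′ (Vec.replicate k a Vec.++ r))) (sym (nextLabel-old a<c′)) (repeat k))

tilde-rgsFrom : ∀ {m} (ns : Fin m → ℕ) → (∀ i → 1 ≤ ns i) →
                ∀ c (τ : Vec ℕ m) → T (rgsFrom c τ) → T (rgsFrom c (tilde ns τ))
tilde-rgsFrom {zero}  ns nonempty c []      t = t
tilde-rgsFrom {suc m} ns nonempty c (a ∷ τ) t =
  rgsFrom-repeated (ns zero) _ (nonempty zero) (rgsFrom-head c a τ t)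
    (tilde-rgsFrom (ns ∘ suc) (nonempty ∘ suc) (nextLabel c a) τ (rgsFrom-tail c a τ t))
module Collapse {m} (ns : Fin m → ℕ) (nonempty : ∀ i → 1 ≤ ns i) where

  tilde-mono : {ρ τ : Vec ℕ m} → ρ ⊑ τ → tilde ns ρ ⊑ tilde ns τ
  tilde-mono {ρ} {τ} ρ⊑τ p q e = begin
    lookup (tilde ns τ) p  ≡⟨ lookup-tilde ns τ p ⟩
    lookup τ (blockOf ns p) ≡⟨ ρ⊑τ _ _ (trans (sym (lookup-tilde ns ρ p)) (trans e (lookup-tilde ns ρ q))) ⟩
    lookup τ (blockOf ns q) ≡⟨ lookup-tilde ns τ q ⟨
    lookup (tilde ns τ) q  ∎
    where open ≡.≡-Reasoning

  lookup-tilde-firstOfBlock : (ρ : Vec ℕ m) (i : Fin m) → lookup (tilde ns ρ) (firstOfBlock ns nonempty i) ≡ lookup ρ i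
  lookup-tilde-firstOfBlock ρ i = trans (lookup-tilde ns ρ _) (cong (lookup ρ) (blockOf-firstOfBlock ns nonempty i))

  tilde-reflects : {ρ τ : Vec ℕ m} → tilde ns ρ ⊑ tilde ns τ → ρ ⊑ τ
  tilde-reflects {ρ} {τ} ρ̃⊑τ̃ i j e =
    trans (sym (lookup-tilde-firstOfBlock τ i))
          (trans (ρ̃⊑τ̃ _ _ (trans (lookup-tilde-firstOfBlock ρ i) (trans e (sym (lookup-tilde-firstOfBlock ρ j)))))
                 (lookup-tilde-firstOfBlock τ j))

  restrict : Vec ℕ (sumF ns) → Vec ℕ m
  restrict η = tabulate (λ i → lookup η (firstOfBlock ns nonempty i))

  tilde-restrict : (η : Vec ℕ (sumF ns)) → tilde ns (0̂ m) ⊑ η → ∀ p → lookup η p ≡ lookup (tilde ns (restrict η)) p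
  tilde-restrict η 0̃⊑η p = trans (0̃⊑η p _ same-block)
    (sym (trans (lookup-tilde ns (restrict η) p) (Vec.lookup∘tabulate (λ i → lookup η (firstOfBlock ns nonempty i)) _)))
    where
    same-block : lookup (tilde ns (0̂ m)) p ≡ lookup (tilde ns (0̂ m)) (firstOfBlock ns nonempty (blockOf ns p))
    same-block = trans (lookup-tilde ns (0̂ m) p) (sym (lookup-tilde-firstOfBlock (0̂ m) (blockOf ns p)))

  edges : Vec ℕ (sumF ns) → List (Fin m × Fin m)
  edges σ = List.map (λ (p , q) → blockOf ns p , blockOf ns q)
                     (filter (λ (p , q) → lookup σ p ≟ lookup σ q) (List.cartesianProduct (allFin _) (allFin _)))

  ∈-edges⁺ : (σ : Vec ℕ (sumF ns)) {p q : Fin (sumF ns)} →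
             lookup σ p ≡ lookup σ q → (blockOf ns p , blockOf ns q) ∈ edges σ
  ∈-edges⁺ σ {p} {q} e = ∈-map⁺ _ (∈-filter⁺ (λ (p , q) → lookup σ p ≟ lookup σ q)
                                              (∈-cartesianProduct⁺ (∈-allFin p) (∈-allFin q)) e)

  ∈-edges⁻ : (σ : Vec ℕ (sumF ns)) {i j : Fin m} → (i , j) ∈ edges σ →
             ∃₂ λ p q → blockOf ns p ≡ i × blockOf ns q ≡ j × lookup σ p ≡ lookup σ q
  ∈-edges⁻ σ e∈ with (p , q) , pq∈ , refl ← ∈-map⁻ _ e∈ =
    p , q , refl , refl , proj₂ (∈-filter⁻ (λ (p , q) → lookup σ p ≟ lookup σ q) {xs = List.cartesianProduct (allFin _) (allFin _)} pq∈)

  -- Merges the blocks of [m] linked by σ; tilde (collapse σ) is σ ∨ 0̃ (isJoin-collapse).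
  collapse : Vec ℕ (sumF ns) → Vec ℕ m
  collapse σ = normalise (mergeAll (0̂ m) (edges σ))

  collapse-isPartition : (σ : Vec ℕ (sumF ns)) → T (isPartition (collapse σ))
  collapse-isPartition σ = normalise-isPartition (mergeAll (0̂ m) (edges σ))

  ⊑-tilde-collapse : (σ : Vec ℕ (sumF ns)) → σ ⊑ tilde ns (collapse σ)
  ⊑-tilde-collapse σ p q e = begin
    lookup (tilde ns (collapse σ)) p    ≡⟨ lookup-tilde ns (collapse σ) p ⟩
    lookup (collapse σ) (blockOf ns p) ≡⟨ ⊑-normalise merged _ _ (mergeAll-joins (0̂ m) (edges σ) (∈-edges⁺ σ e)) ⟩
    lookup (collapse σ) (blockOf ns q) ≡⟨ lookup-tilde ns (collapse σ) q ⟨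
    lookup (tilde ns (collapse σ)) q    ∎
    where
    open ≡.≡-Reasoning
    merged = mergeAll (0̂ m) (edges σ)

  collapse-⊑ : (σ : Vec ℕ (sumF ns)) (τ : Vec ℕ m) → σ ⊑ tilde ns τ → collapse σ ⊑ τ
  collapse-⊑ σ τ σ⊑τ̃ = ⊑-trans {x = collapse σ} {merged} {τ} (normalise-⊑ merged)
                                (mergeAll-⊑ {L = 0̂ m} {τ} (edges σ) (0̂-⊑ τ) respects)
    where
    merged = mergeAll (0̂ m) (edges σ)
    respects : ∀ {i j} → (i , j) ∈ edges σ → lookup τ i ≡ lookup τ j
    respects e∈ with p , q , refl , refl , e ← ∈-edges⁻ σ e∈ =
      trans (sym (lookup-tilde ns τ p)) (trans (σ⊑τ̃ p q e) (lookup-tilde ns τ q))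

  collapse-≤ₚ≡≤ₚ-tilde : (σ : Vec ℕ (sumF ns)) (τ : Vec ℕ m) → (collapse σ ≤ₚ τ) ≡ (σ ≤ₚ tilde ns τ)
  collapse-≤ₚ≡≤ₚ-tilde σ τ = T-ext
    (λ t → ⊑⇒≤ₚ σ (tilde ns τ) (⊑-trans {x = σ} {tilde ns (collapse σ)} {tilde ns τ} (⊑-tilde-collapse σ)
                                          (tilde-mono {collapse σ} {τ} (≤ₚ⇒⊑ (collapse σ) τ t))))
    (λ t → ⊑⇒≤ₚ (collapse σ) τ (collapse-⊑ σ τ (≤ₚ⇒⊑ σ (tilde ns τ) t)))

  isJoin-collapse : (σ : Vec ℕ (sumF ns)) → T (isJoin σ (tilde ns (0̂ m)) (tilde ns (collapse σ)))
  isJoin-collapse σ = isJoin⁺ σ (tilde ns (0̂ m)) (tilde ns (collapse σ))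
    (⊑-tilde-collapse σ) (tilde-mono {0̂ m} {collapse σ} (0̂-⊑ (collapse σ))) least
    where
    least : ∀ η → σ ⊑ η → tilde ns (0̂ m) ⊑ η → tilde ns (collapse σ) ⊑ η
    least η σ⊑η 0̃⊑η p q e = trans (η≡ p) (trans (tilde-mono {collapse σ} {restrict η} collapse⊑ p q e) (sym (η≡ q)))
      where
      η≡ = tilde-restrict η 0̃⊑η
      collapse⊑ = collapse-⊑ σ (restrict η) λ p q e → trans (sym (η≡ p)) (trans (σ⊑η p q e) (η≡ q))

  isJoin⇒collapse : (σ : Vec ℕ (sumF ns)) (ρ : Vec ℕ m) → T (isPartition ρ) →
                    T (isJoin σ (tilde ns (0̂ m)) (tilde ns ρ)) → ρ ≡ collapse σ
  isJoin⇒collapse σ ρ tρ t with σ⊑ρ̃ , least ← isJoin⁻ σ (tilde ns (0̂ m)) (tilde ns ρ) t =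
    partition-unique ρ (collapse σ) tρ (collapse-isPartition σ)
      (tilde-reflects {ρ} {collapse σ}
        (least (tilde ns (collapse σ)) (tilde-rgsFrom ns nonempty 0 (collapse σ) (collapse-isPartition σ))
                                        (⊑-tilde-collapse σ) (tilde-mono {0̂ m} {collapse σ} (0̂-⊑ (collapse σ)))))
      (collapse-⊑ σ ρ σ⊑ρ̃)

-- Sums over partitions

module SumProperties {c ℓ} (S : CommutativeRing c ℓ) where
  open CommutativeRing S renaming (refl to ≈-refl; sym to ≈-sym; trans to ≈-trans)
  open import Algebra.Properties.CommutativeSemigroup +-commutativeSemigroup using (interchange)
  open import Relation.Binary.Reasoning.Setoid setoid

  if-true : ∀ b {a} → T b → (if b then a else 0#) ≈ a
  if-true true _ = ≈-refl

  if-false : ∀ b {a} → ¬ T b → (if b then a else 0#) ≈ 0#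
  if-false true  ¬b = contradiction tt ¬b
  if-false false _  = ≈-refl

  if-cong : ∀ b {a a′} → (T b → a ≈ a′) → (if b then a else 0#) ≈ (if b then a′ else 0#)
  if-cong true  h = h tt
  if-cong false _ = ≈-refl

  if-split : ∀ a b (f : Carrier) → (if a then f else 0#) ≈ (if a ∧ b then f else 0#) + (if a ∧ not b then f else 0#)
  if-split true  true  f = ≈-sym (+-identityʳ f)
  if-split true  false f = ≈-sym (+-identityˡ f)
  if-split false b     f = ≈-sym (+-identityˡ 0#)

  if-if-* : ∀ a b (x y : Carrier) → (if a then (if b then x * y else 0#) else 0#) ≈ x * (if b ∧ a then y else 0#)
  if-if-* true  true  x y = ≈-refl
  if-if-* true  false x y = ≈-sym (zeroʳ x)
  if-if-* false true  x y = ≈-sym (zeroʳ x)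
  if-if-* false false x y = ≈-sym (zeroʳ x)

  module _ {x} {X : Set x} where

    sumL-cong : ∀ (L : List X) {f g : X → Carrier} → (∀ x → x ∈ L → f x ≈ g x) → sumL S L f ≈ sumL S L g
    sumL-cong []      h = ≈-refl
    sumL-cong (x ∷ L) h = +-cong (h x (here ≡.refl)) (sumL-cong L λ y y∈ → h y (there y∈))

    sumL-zero : ∀ (L : List X) {f : X → Carrier} → (∀ x → x ∈ L → f x ≈ 0#) → sumL S L f ≈ 0#
    sumL-zero []      h = ≈-refl
    sumL-zero (x ∷ L) h =
      ≈-trans (+-cong (h x (here ≡.refl)) (sumL-zero L λ y y∈ → h y (there y∈))) (+-identityˡ 0#)

    sumL-+ : ∀ (L : List X) (f g : X → Carrier) → sumL S L (λ x → f x + g x) ≈ sumL S L f + sumL S L g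
    sumL-+ []      f g = ≈-sym (+-identityˡ 0#)
    sumL-+ (x ∷ L) f g = ≈-trans (+-congˡ (sumL-+ L f g)) (interchange (f x) (g x) _ _)

    sumL-*ˡ : ∀ (L : List X) a (f : X → Carrier) → sumL S L (λ x → a * f x) ≈ a * sumL S L f
    sumL-*ˡ []      a f = ≈-sym (zeroʳ a)
    sumL-*ˡ (x ∷ L) a f = ≈-trans (+-congˡ (sumL-*ˡ L a f)) (≈-sym (distribˡ a _ _))

    sumL-unique-delta : ∀ {L : List X} {v} (g : X → Carrier) → Unique L → v ∈ L →
                        (∀ x → x ∈ L → x ≢ v → g x ≈ 0#) → sumL S L g ≈ g v
    sumL-unique-delta {x ∷ L} g (x∉L ∷ _) (here ≡.refl) h =
      ≈-trans (+-congˡ (sumL-zero L λ y y∈ → h y (there y∈) (λ { ≡.refl → All.lookup x∉L y∈ ≡.refl })))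
              (+-identityʳ _)
    sumL-unique-delta {x ∷ L} g (x∉L ∷ uniq) (there v∈) h =
      ≈-trans (+-congʳ (h x (here ≡.refl) (λ { ≡.refl → All.lookup x∉L v∈ ≡.refl })))
            (≈-trans (+-identityˡ _) (sumL-unique-delta g uniq v∈ λ y y∈ → h y (there y∈)))

    sumL-filter : ∀ (p : X → Bool) (L : List X) (f : X → Carrier) →
                  sumL S (filter (λ x → T? (p x)) L) f ≈ sumWhere S L p f
    sumL-filter p []      f = ≈-refl
    sumL-filter p (x ∷ L) f with p x
    ... | true  = +-congˡ (sumL-filter p L f)
    ... | false = ≈-trans (sumL-filter p L f) (≈-sym (+-identityˡ _))

    sumL-if : ∀ b (L : List X) (f : X → Carrier) →
              (if b then sumL S L f else 0#) ≈ sumL S L (λ x → if b then f x else 0#)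
    sumL-if true  L f = ≈-refl
    sumL-if false L f = ≈-sym (sumL-zero L λ _ _ → ≈-refl)

    sumWhere-cong : ∀ (L : List X) {p q : X → Bool} (f : X → Carrier) →
                    (∀ x → p x ≡ q x) → sumWhere S L p f ≈ sumWhere S L q f
    sumWhere-cong L f p≡q = sumL-cong L λ x _ → reflexive (cong (λ b → if b then f x else 0#) (p≡q x))

  module _ {x y} {X : Set x} {Y : Set y} where

    sumL-swap : ∀ (L : List X) (M : List Y) (g : X → Y → Carrier) →
                sumL S L (λ x → sumL S M (g x)) ≈ sumL S M (λ y → sumL S L (λ x → g x y))
    sumL-swap []      M g = ≈-sym (sumL-zero M λ _ _ → ≈-refl)
    sumL-swap (x ∷ L) M g = ≈-trans (+-congˡ (sumL-swap L M g)) (≈-sym (sumL-+ M (g x) _))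

    sumL-map : ∀ (h : X → Y) (L : List X) (f : Y → Carrier) → sumL S (List.map h L) f ≈ sumL S L (λ x → f (h x))
    sumL-map h []      f = ≈-refl
    sumL-map h (x ∷ L) f = +-congˡ (sumL-map h L f)

    sumL-concatMap : ∀ (h : X → List Y) (L : List X) (f : Y → Carrier) →
                     sumL S (List.concatMap h L) f ≈ sumL S L (λ x → sumL S (h x) f)
    sumL-concatMap h []      f = ≈-refl
    sumL-concatMap h (x ∷ L) f = ≈-trans (sumL-++ (h x) _) (+-congˡ (sumL-concatMap h L f))
      where
      sumL-++ : ∀ (L M : List Y) → sumL S (L List.++ M) f ≈ sumL S L f + sumL S M f
      sumL-++ []      M = ≈-sym (+-identityˡ _)
      sumL-++ (y ∷ L) M = ≈-trans (+-congˡ (sumL-++ L M)) (≈-sym (+-assoc _ _ _))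

  sumL-allVecs-delta : ∀ k (v : Vec ℕ n) → All (_< k) v → (g : Vec ℕ n → Carrier) →
                       (∀ x → x ≢ v → g x ≈ 0#) → sumL S (allVecs k n) g ≈ g v
  sumL-allVecs-delta k []      []          g _ = +-identityʳ _
  sumL-allVecs-delta {suc n} k (a ∷ v) (a<k ∷ v<k) g h = begin
    sumL S (allVecs k (suc n)) g
      ≈⟨ sumL-concatMap (λ b → List.map (b ∷_) (allVecs k n)) (upTo k) g ⟩
    sumL S (upTo k) (λ b → sumL S (List.map (b ∷_) (allVecs k n)) g)
      ≈⟨ sumL-cong (upTo k) (λ b _ → sumL-map (Vec._∷_ b) (allVecs k n) g) ⟩
    sumL S (upTo k) (λ b → sumL S (allVecs k n) (λ x → g (b ∷ x)))
      ≈⟨ sumL-unique-delta (λ b → sumL S (allVecs k n) (λ x → g (b ∷ x))) (upTo⁺ k) (∈-upTo⁺ a<k)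
           (λ b _ b≢a → sumL-zero (allVecs k n) λ x _ → h (b ∷ x) (λ e → b≢a (Vec.∷-injectiveˡ e))) ⟩
    sumL S (allVecs k n) (λ x → g (a ∷ x))
      ≈⟨ sumL-allVecs-delta k v v<k _ (λ x x≢v → h (a ∷ x) (λ e → x≢v (Vec.∷-injectiveʳ e))) ⟩
    g (a ∷ v) ∎

  sumL-Π-delta : (v : Vec ℕ n) → T (isPartition v) → (g : Vec ℕ n → Carrier) →
                 (∀ x → T (isPartition x) → x ≢ v → g x ≈ 0#) → sumL S (Π n) g ≈ g v
  sumL-Π-delta {n} v tv g h = begin
    sumL S (Π n) g
      ≈⟨ sumL-filter isPartition (allVecs n n) g ⟩
    sumWhere S (allVecs n n) isPartition g
      ≈⟨ sumL-allVecs-delta n v (rgsFrom-bounded 0 n v tv ≤-refl) _ vanish ⟩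
    (if isPartition v then g v else 0#)
      ≈⟨ if-true (isPartition v) tv ⟩
    g v ∎
    where
    vanish : ∀ x → x ≢ v → (if isPartition x then g x else 0#) ≈ 0#
    vanish x x≢v with isPartition x in eq
    ... | true  = h x (subst T (sym eq) tt) x≢v
    ... | false = ≈-refl

  sumWhere-splitTop : (p : Vec ℕ n → Bool) (ρ : Vec ℕ n) → T (isPartition ρ) → T (p ρ) → (f : Vec ℕ n → Carrier) →
    sumWhere S (Π n) p f ≈ f ρ + sumWhere S (Π n) (λ σ → p σ ∧ not (σ ≈ₚ ρ)) f
  sumWhere-splitTop {n} p ρ tρ pρ f = begin
    sumWhere S (Π n) p f
      ≈⟨ sumL-cong (Π n) (λ σ _ → if-split (p σ) (σ ≈ₚ ρ) (f σ)) ⟩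
    sumL S (Π n) (λ σ → (if p σ ∧ (σ ≈ₚ ρ) then f σ else 0#) + (if p σ ∧ not (σ ≈ₚ ρ) then f σ else 0#))
      ≈⟨ sumL-+ (Π n) _ _ ⟩
    sumWhere S (Π n) (λ σ → p σ ∧ (σ ≈ₚ ρ)) f + sumWhere S (Π n) (λ σ → p σ ∧ not (σ ≈ₚ ρ)) f
      ≈⟨ +-congʳ (sumL-Π-delta ρ tρ _ λ σ tσ σ≢ρ → if-false (p σ ∧ (σ ≈ₚ ρ))
                    λ t → σ≢ρ (≈ₚ⇒≡ σ ρ tσ tρ (T-∧ʳ {p σ} t))) ⟩
    (if p ρ ∧ (ρ ≈ₚ ρ) then f ρ else 0#) + sumWhere S (Π n) (λ σ → p σ ∧ not (σ ≈ₚ ρ)) f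
      ≈⟨ +-congʳ (if-true (p ρ ∧ (ρ ≈ₚ ρ)) (T-∧⁺ pρ (≈ₚ-refl ρ))) ⟩
    f ρ + sumWhere S (Π n) (λ σ → p σ ∧ not (σ ≈ₚ ρ)) f ∎

-- Möbius inversion on the partition lattice

module MöbiusInversion {c ℓ} (S : CommutativeRing c ℓ) where
  open CommutativeRing S renaming (refl to ≈-refl; sym to ≈-sym; trans to ≈-trans)
  open SumProperties S
  open import Relation.Binary.Reasoning.Setoid setoid

  inHalfOpenInterval : Vec ℕ n → Vec ℕ n → Vec ℕ n → Bool
  inHalfOpenInterval x y z = (x ≤ₚ z) ∧ (z ≤ₚ y) ∧ not (z ≈ₚ y)

  -- Each step of a strict chain from x to y loses a block.
  möbiusF-stable : ∀ k (x y : Vec ℕ n) → blockCount x ∸ blockCount y ≤ k →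
                   möbiusF S k x y ≈ möbiusF S (suc k) x y
  möbiusF-stable zero x y bound with x ≈ₚ y in x≈y
  ... | true  = ≈-refl
  ... | false with x ≤ₚ y in x≤y
  ...   | false = ≈-refl
  ...   | true  = contradiction (ℕ.m<n⇒0<n∸m by<bx) (ℕ.≤⇒≯ bound)
    where by<bx = blockCount-<ₚ x y (subst T (sym x≤y) tt) (λ y≤x → subst T x≈y y≤x)
  möbiusF-stable {n} (suc k) x y bound with x ≈ₚ y in x≈y
  ... | true  = ≈-refl
  ... | false with x ≤ₚ y in x≤y
  ...   | false = ≈-refl
  ...   | true  = -‿cong (sumL-cong (Π n) λ z _ → if-cong (inHalfOpenInterval x y z) λ t →
      möbiusF-stable k x z (≤-trans (ℕ.∸-monoʳ-≤ (blockCount x) (by<bz z t))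
                                    (subst (_≤ k) (ℕ.pred[m∸n]≡m∸[1+n] (blockCount x) (blockCount y))
                                           (ℕ.pred-mono-≤ bound))))
    where
    by<bz : ∀ z → T (inHalfOpenInterval x y z) → blockCount y < blockCount z
    by<bz z t = blockCount-<ₚ z y z≤y (λ y≤z → T-not⁻ (T-∧ʳ {z ≤ₚ y} t′) (T-∧⁺ z≤y y≤z))
      where
      t′ = T-∧ʳ {x ≤ₚ z} t
      z≤y = T-∧ˡ t′

  möbiusF-diagonal : ∀ k (x : Vec ℕ n) → möbiusF S k x x ≈ 1#
  möbiusF-diagonal zero    x with x ≈ₚ x | ≈ₚ-refl x
  ... | true | _ = ≈-refl
  möbiusF-diagonal (suc k) x with x ≈ₚ x | ≈ₚ-refl x
  ... | true | _ = ≈-refl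

  μ-recursion : ∀ {k} (x y : Vec ℕ (suc k)) → x ≤ₚ y ≡ true → y ≤ₚ x ≡ false →
                μ S x y ≈ - sumWhere S (Π (suc k)) (inHalfOpenInterval x y) (μ S x)
  μ-recursion {k} x y x≤y y≰x rewrite x≤y | y≰x =
    -‿cong (sumL-cong (Π (suc k)) λ z _ → if-cong (inHalfOpenInterval x y z) λ _ →
      möbiusF-stable k x z (≤-trans (ℕ.∸-monoʳ-≤ (blockCount x) (blockCount-pos z))
                                    (ℕ.∸-monoˡ-≤ 1 (blockCount≤n x))))

  sumWhere-μ-interval : (κ ρ : Vec ℕ n) → T (isPartition κ) → T (isPartition ρ) →
    sumWhere S (Π n) (λ σ → (κ ≤ₚ σ) ∧ (σ ≤ₚ ρ)) (μ S κ) ≈ (if κ ≈ₚ ρ then 1# else 0#)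
  sumWhere-μ-interval {zero} [] [] _ _ = +-identityʳ 1#
  sumWhere-μ-interval {suc k} κ ρ tκ tρ with κ ≈ₚ ρ in κ≈ρ
  ... | true with refl ← ≈ₚ⇒≡ κ ρ tκ tρ (subst T (sym κ≈ρ) tt) = begin
    sumWhere S (Π (suc k)) (λ σ → (κ ≤ₚ σ) ∧ (σ ≤ₚ κ)) (μ S κ)
      ≈⟨ sumL-Π-delta κ tκ _ (λ σ tσ σ≢κ → if-false ((κ ≤ₚ σ) ∧ (σ ≤ₚ κ)) λ t →
           σ≢κ (partition-unique σ κ tσ tκ (≤ₚ⇒⊑ σ κ (T-∧ʳ {κ ≤ₚ σ} t)) (≤ₚ⇒⊑ κ σ (T-∧ˡ t)))) ⟩
    (if (κ ≤ₚ κ) ∧ (κ ≤ₚ κ) then μ S κ κ else 0#)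
      ≈⟨ if-true ((κ ≤ₚ κ) ∧ (κ ≤ₚ κ)) (T-∧⁺ (≤ₚ-refl κ) (≤ₚ-refl κ)) ⟩
    μ S κ κ
      ≈⟨ möbiusF-diagonal (suc k) κ ⟩
    1# ∎
  ... | false with κ ≤ₚ ρ in κ≤ρ
  ...   | false = sumL-zero (Π (suc k)) λ σ _ → if-false ((κ ≤ₚ σ) ∧ (σ ≤ₚ ρ)) λ t →
      subst T κ≤ρ (⊑⇒≤ₚ κ ρ (⊑-trans {x = κ} {σ} {ρ} (≤ₚ⇒⊑ κ σ (T-∧ˡ t)) (≤ₚ⇒⊑ σ ρ (T-∧ʳ {κ ≤ₚ σ} t))))
  ...   | true = begin
    sumWhere S (Π (suc k)) (λ σ → (κ ≤ₚ σ) ∧ (σ ≤ₚ ρ)) (μ S κ)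
      ≈⟨ sumWhere-splitTop (λ σ → (κ ≤ₚ σ) ∧ (σ ≤ₚ ρ)) ρ tρ (T-∧⁺ (subst T (sym κ≤ρ) tt) (≤ₚ-refl ρ)) (μ S κ) ⟩
    μ S κ ρ + sumWhere S (Π (suc k)) (λ σ → ((κ ≤ₚ σ) ∧ (σ ≤ₚ ρ)) ∧ not (σ ≈ₚ ρ)) (μ S κ)
      ≈⟨ +-cong (μ-recursion κ ρ κ≤ρ κ≈ρ)
                (sumWhere-cong (Π (suc k)) (μ S κ) λ σ → ∧-assoc (κ ≤ₚ σ) (σ ≤ₚ ρ) _) ⟩
    - strictSum + strictSum
      ≈⟨ -‿inverseˡ strictSum ⟩
    0# ∎
    where strictSum = sumWhere S (Π (suc k)) (inHalfOpenInterval κ ρ) (μ S κ)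
  cumulant : (Vec ℕ n → Carrier) → Vec ℕ n → Carrier
  cumulant {n} φ σ = sumWhere S (Π n) (_≤ₚ σ) (λ τ → φ τ * μ S τ σ)

  sum-cumulant : (φ : Vec ℕ n → Carrier) (ρ : Vec ℕ n) → T (isPartition ρ) →
                 sumWhere S (Π n) (_≤ₚ ρ) (cumulant φ) ≈ φ ρ
  sum-cumulant {n} φ ρ tρ = begin
    sumWhere S (Π n) (_≤ₚ ρ) (cumulant φ)
      ≈⟨ sumL-cong (Π n) (λ σ _ → sumL-if (σ ≤ₚ ρ) (Π n) _) ⟩
    sumL S (Π n) (λ σ → sumL S (Π n) λ τ → if σ ≤ₚ ρ then (if τ ≤ₚ σ then φ τ * μ S τ σ else 0#) else 0#)
      ≈⟨ sumL-swap (Π n) (Π n) _ ⟩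
    sumL S (Π n) (λ τ → sumL S (Π n) λ σ → if σ ≤ₚ ρ then (if τ ≤ₚ σ then φ τ * μ S τ σ else 0#) else 0#)
      ≈⟨ sumL-cong (Π n) (λ τ _ → ≈-trans (sumL-cong (Π n) λ σ _ → if-if-* (σ ≤ₚ ρ) (τ ≤ₚ σ) (φ τ) (μ S τ σ))
                                          (sumL-*ˡ (Π n) (φ τ) _)) ⟩
    sumL S (Π n) (λ τ → φ τ * sumWhere S (Π n) (λ σ → (τ ≤ₚ σ) ∧ (σ ≤ₚ ρ)) (μ S τ))
      ≈⟨ sumL-cong (Π n) (λ τ τ∈ → *-congˡ (sumWhere-μ-interval τ ρ (∈Π⁻ τ∈) tρ)) ⟩
    sumL S (Π n) (λ τ → φ τ * (if τ ≈ₚ ρ then 1# else 0#))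
      ≈⟨ sumL-Π-delta ρ tρ _ (λ τ tτ τ≢ρ →
           ≈-trans (*-congˡ (if-false (τ ≈ₚ ρ) λ t → τ≢ρ (≈ₚ⇒≡ τ ρ tτ tρ t))) (zeroʳ (φ τ))) ⟩
    φ ρ * (if ρ ≈ₚ ρ then 1# else 0#)
      ≈⟨ *-congˡ (if-true (ρ ≈ₚ ρ) (≈ₚ-refl ρ)) ⟩
    φ ρ * 1#
      ≈⟨ *-identityʳ (φ ρ) ⟩
    φ ρ ∎

  lowerSums-injective : (F G : Vec ℕ n → Carrier) →
    (∀ τ → T (isPartition τ) → sumWhere S (Π n) (_≤ₚ τ) F ≈ sumWhere S (Π n) (_≤ₚ τ) G) →
    ∀ π → T (isPartition π) → F π ≈ G π
  lowerSums-injective {n} F G sums≈ π = agree π (<-wellFounded (n ∸ blockCount π))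
    where
    open import Algebra.Properties.Group +-group using (∙-cancelʳ)
    strictSum : (Vec ℕ n → Carrier) → Vec ℕ n → Carrier
    strictSum H π = sumWhere S (Π n) (λ ρ → (ρ ≤ₚ π) ∧ not (ρ ≈ₚ π)) H
    agree : ∀ π → Acc _<_ (n ∸ blockCount π) → T (isPartition π) → F π ≈ G π
    agree π (acc smaller) tπ = ∙-cancelʳ (strictSum G π) (F π) (G π) (begin
      F π + strictSum G π ≈⟨ +-congˡ (sumL-cong (Π n) λ ρ ρ∈ → if-cong _ (below ρ ρ∈)) ⟨
      F π + strictSum F π ≈⟨ sumWhere-splitTop (_≤ₚ π) π tπ (≤ₚ-refl π) F ⟨
      sumWhere S (Π n) (_≤ₚ π) F ≈⟨ sums≈ π tπ ⟩
      sumWhere S (Π n) (_≤ₚ π) G ≈⟨ sumWhere-splitTop (_≤ₚ π) π tπ (≤ₚ-refl π) G ⟩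
      G π + strictSum G π ∎)
      where
      below : ∀ ρ → ρ ∈ Π n → T ((ρ ≤ₚ π) ∧ not (ρ ≈ₚ π)) → F ρ ≈ G ρ
      below ρ ρ∈ t = agree ρ (smaller (ℕ.∸-monoʳ-< bπ<bρ (blockCount≤n ρ))) (∈Π⁻ ρ∈)
        where
        ρ≤π = T-∧ˡ t
        bπ<bρ = blockCount-<ₚ ρ π ρ≤π λ π≤ρ → T-not⁻ (T-∧ʳ {ρ ≤ₚ π} t) (T-∧⁺ ρ≤π π≤ρ)
module JoinSums {c ℓ} (S : CommutativeRing c ℓ) {m} (ns : Fin m → ℕ) (nonempty : ∀ i → 1 ≤ ns i) where
  open CommutativeRing S renaming (refl to ≈-refl; sym to ≈-sym; trans to ≈-trans)
  open SumProperties S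
  open Collapse ns nonempty
  open import Relation.Binary.Reasoning.Setoid setoid

  sumWhere-isJoin-indicator : (σ : Vec ℕ (sumF ns)) (τ : Vec ℕ m) (x : Carrier) →
    sumWhere S (Π m) (_≤ₚ τ) (λ ρ → if isJoin σ (tilde ns (0̂ m)) (tilde ns ρ) then x else 0#)
      ≈ (if σ ≤ₚ tilde ns τ then x else 0#)
  sumWhere-isJoin-indicator σ τ x = begin
    sumWhere S (Π m) (_≤ₚ τ) (λ ρ → if joins ρ then x else 0#)
      ≈⟨ sumL-Π-delta (collapse σ) (collapse-isPartition σ) _ (λ ρ tρ ρ≢ → vanish ρ tρ ρ≢ (ρ ≤ₚ τ)) ⟩
    (if collapse σ ≤ₚ τ then (if joins (collapse σ) then x else 0#) else 0#)
      ≈⟨ if-cong (collapse σ ≤ₚ τ) (λ _ → if-true (joins (collapse σ)) (isJoin-collapse σ)) ⟩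
    (if collapse σ ≤ₚ τ then x else 0#)
      ≡⟨ cong (λ b → if b then x else 0#) (collapse-≤ₚ≡≤ₚ-tilde σ τ) ⟩
    (if σ ≤ₚ tilde ns τ then x else 0#) ∎
    where
    joins : Vec ℕ m → Bool
    joins ρ = isJoin σ (tilde ns (0̂ m)) (tilde ns ρ)
    vanish : ∀ ρ → T (isPartition ρ) → ρ ≢ collapse σ → ∀ b → (if b then (if joins ρ then x else 0#) else 0#) ≈ 0#
    vanish ρ tρ ρ≢ true  = if-false (joins ρ) λ t → ρ≢ (isJoin⇒collapse σ ρ tρ t)
    vanish ρ tρ ρ≢ false = ≈-refl

  sumWhere-isJoin : (g : Vec ℕ (sumF ns) → Carrier) (τ : Vec ℕ m) →
    sumWhere S (Π m) (_≤ₚ τ) (λ ρ → sumWhere S (Π (sumF ns)) (λ σ → isJoin σ (tilde ns (0̂ m)) (tilde ns ρ)) g)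
      ≈ sumWhere S (Π (sumF ns)) (_≤ₚ tilde ns τ) g
  sumWhere-isJoin g τ = begin
    sumWhere S (Π m) (_≤ₚ τ) (λ ρ → sumWhere S (Π (sumF ns)) (λ σ → isJoin σ (tilde ns (0̂ m)) (tilde ns ρ)) g)
      ≈⟨ sumL-cong (Π m) (λ ρ _ → sumL-if (ρ ≤ₚ τ) (Π (sumF ns)) _) ⟩
    sumL S (Π m) (λ ρ → sumL S (Π (sumF ns)) λ σ →
      if ρ ≤ₚ τ then (if isJoin σ (tilde ns (0̂ m)) (tilde ns ρ) then g σ else 0#) else 0#)
      ≈⟨ sumL-swap (Π m) (Π (sumF ns)) _ ⟩
    sumL S (Π (sumF ns)) (λ σ → sumWhere S (Π m) (_≤ₚ τ) λ ρ →
      if isJoin σ (tilde ns (0̂ m)) (tilde ns ρ) then g σ else 0#)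
      ≈⟨ sumL-cong (Π (sumF ns)) (λ σ _ → sumWhere-isJoin-indicator σ τ (g σ)) ⟩
    sumWhere S (Π (sumF ns)) (_≤ₚ tilde ns τ) g ∎

prodV-++ : ∀ {a ℓa} (R : Ring a ℓa) {k l} (xs : Vec (Ring.Carrier R) k) (ys : Vec (Ring.Carrier R) l) →
           Ring._≈_ R (prodV R (xs Vec.++ ys)) (Ring._*_ R (prodV R xs) (prodV R ys))
prodV-++ R []       ys = Ring.sym R (Ring.*-identityˡ R _)
prodV-++ R (x ∷ xs) ys = Ring.trans R (Ring.*-congˡ R (prodV-++ R xs ys)) (Ring.sym R (Ring.*-assoc R _ _ _))

module _ {c ℓ a ℓa u ℓu} {S : CommutativeRing c ℓ} {P : NCProbSpace S a ℓa} (E : ExchangeabilitySystem P u ℓu) where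
  private
    module A = NCProbSpace P
    module Ex = ExchangeabilitySystem E
    module U = NCProbSpace Ex.𝒰

  ι-prodV : ∀ {k} b (xs : Vec A.Carrier k) →
            Ex.ι b (prodV A.ring xs) U.≈ prodV U.ring (Vec.zipWith Ex.ι (Vec.replicate k b) xs)
  ι-prodV b []       = Ex.ι-1 b
  ι-prodV b (x ∷ xs) = U.trans (Ex.ι-* b x _) (U.*-congˡ (ι-prodV b xs))

  ι-prodV-tilde : ∀ {m} (ns : Fin m → ℕ) (xs : (i : Fin m) → Vec A.Carrier (ns i)) (τ : Vec ℕ m) →
    prodV U.ring (Vec.zipWith Ex.ι τ (tabulate (λ i → prodV A.ring (xs i))))
      U.≈ prodV U.ring (Vec.zipWith Ex.ι (tilde ns τ) (concatF ns xs))
  ι-prodV-tilde ns xs []      = U.refl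
  ι-prodV-tilde ns xs (b ∷ τ) = begin
    Ex.ι b (prodV A.ring (xs zero)) U.* prodV U.ring (Vec.zipWith Ex.ι τ (tabulate (λ i → prodV A.ring (xs (suc i)))))
      ≈⟨ U.*-cong (ι-prodV b (xs zero)) (ι-prodV-tilde (ns ∘ suc) (xs ∘ suc) τ) ⟩
    prodV U.ring first U.* prodV U.ring rest
      ≈⟨ prodV-++ U.ring first rest ⟨
    prodV U.ring (first Vec.++ rest)
      ≡⟨ cong (prodV U.ring) (Vec.zipWith-++ Ex.ι (Vec.replicate (ns zero) b) _ (xs zero) _) ⟨
    prodV U.ring (Vec.zipWith Ex.ι (tilde ns (b ∷ τ)) (concatF ns xs)) ∎
    where
    open import Relation.Binary.Reasoning.Setoid U.setoid
    first : Vec U.Carrier (ns zero)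
    first = Vec.zipWith Ex.ι (Vec.replicate (ns zero) b) (xs zero)
    rest : Vec U.Carrier (sumF (ns ∘ suc))
    rest = Vec.zipWith Ex.ι (tilde (ns ∘ suc) τ) (concatF (ns ∘ suc) (xs ∘ suc))

proposition3p4 : ∀ {c ℓ a ℓa u ℓu} {S : CommutativeRing c ℓ} {P : NCProbSpace S a ℓa}
  (E : ExchangeabilitySystem P u ℓu)
  (m : ℕ) (ns : Fin m → ℕ) → (∀ i → 1 ≤ ns i) →
  (X : (i : Fin m) → Fin (ns i) → NCProbSpace.Carrier P) →
  (π : Vec ℕ m) → T (isPartition π) →
  CommutativeRing._≈_ S
    (K E π (tabulate (λ i → prodV (NCProbSpace.ring P) (tabulate (X i)))))
    (sumWhere S (Π (sumF ns)) (λ σ → isJoin σ (tilde ns (0̂ m)) (tilde ns π))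
      (λ σ → K E σ (concatF ns (λ i → tabulate (X i)))))
proposition3p4 {S = S} {P} E m ns nonempty X = lowerSums-injective (λ ρ → K E ρ products) rhs sameLowerSums
  where
  open CommutativeRing S using (Carrier; _≈_; setoid)
  open MöbiusInversion S
  open JoinSums S ns nonempty
  open import Relation.Binary.Reasoning.Setoid setoid
  products : Vec (NCProbSpace.Carrier P) m
  products = tabulate (λ i → prodV (NCProbSpace.ring P) (tabulate (X i)))
  factors : Vec (NCProbSpace.Carrier P) (sumF ns)
  factors = concatF ns (λ i → tabulate (X i))
  rhs : Vec ℕ m → Carrier
  rhs ρ = sumWhere S (Π (sumF ns)) (λ σ → isJoin σ (tilde ns (0̂ m)) (tilde ns ρ)) (λ σ → K E σ factors)
  sameLowerSums : ∀ τ → T (isPartition τ) →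
                  sumWhere S (Π m) (_≤ₚ τ) (λ ρ → K E ρ products) ≈ sumWhere S (Π m) (_≤ₚ τ) rhs
  sameLowerSums τ tτ = begin
    sumWhere S (Π m) (_≤ₚ τ) (λ ρ → K E ρ products)
      ≈⟨ sum-cumulant (λ ρ → φₚ E ρ products) τ tτ ⟩
    φₚ E τ products
      ≈⟨ NCProbSpace.φ-cong (ExchangeabilitySystem.𝒰 E) (ι-prodV-tilde E ns (λ i → tabulate (X i)) τ) ⟩
    φₚ E (tilde ns τ) factors
      ≈⟨ sum-cumulant (λ σ → φₚ E σ factors) (tilde ns τ) (tilde-rgsFrom ns nonempty 0 τ tτ) ⟨
    sumWhere S (Π (sumF ns)) (_≤ₚ tilde ns τ) (λ σ → K E σ factors)
      ≈⟨ sumWhere-isJoin (λ σ → K E σ factors) τ ⟨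
    sumWhere S (Π m) (_≤ₚ τ) rhs ∎
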